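{- Let $n\ge1$ and let $l$ be a link-irregular labeling of the complete graph $K_n$ using only two labels, say $1$ and $2$. Then the spanning subgraph $G_1$ of $K_n$ with vertex set $V(K_n)$ and edge set the edges labeled $1$ is a cut-irregular graph on $n$ vertices. Conversely, if $G$ is a cut-irregular graph on $n$ vertices, then labeling the edges of a spanning subgraph of $K_n$ isomorphic to $G$ with label $1$ and all remaining edges of $K_n$ with label $2$ yields a link-irregular labeling of $K_n$ using at most two labels.
   Context: All graphs are finite and simple. A graph $G$ is cut-irregular if for all distinct $u,v\in V(G)$, the vertex-deleted subgraphs $G-u$ and $G-v$ are non-isomorphic. For a vertex $v$, its link is $L(v)=G[N(v)]$. An edge-labeling is a map $l:E(G)\to\mathbb{Z}^+$; the labeled link $L_l(v)$ is $L(v)$ with edges carrying their labels; labeled graphs are isomorphic if there is a label-preserving isomorphism. A labeling is link-irregular if $L_l(u)\not\cong L_l(v)$ for all distinct $u,v$. -}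

module Defs where

open import Data.Nat using (ℕ; _≤_)
open import Data.Nat.Properties using () renaming (_≟_ to _≟ℕ_)
open import Data.Fin using (Fin; _≟_)
open import Data.Bool using (Bool; true; false; not; _∧_; if_then_else_; T)
open import Data.Product using (Σ; _,_; proj₁; _×_)
open import Data.Sum using (_⊎_)
open import Data.Empty using (⊥)
open import Relation.Nullary using (¬_; yes; no)
open import Relation.Nullary.Decidable using (⌊_⌋; False)
open import Relation.Binary.PropositionalEquality using (_≡_; refl; _≢_; sym; cong)
open import Function.Bundles using (_⤖_; Bijection)

record Graph (n : ℕ) : Set where
  field
    adj    : Fin n → Fin n → Bool
    adj-sym : ∀ u v → adj u v ≡ adj v u
    adj-irr : ∀ v → adj v v ≡ false
open Graph public

Edge : ∀ {n} → Graph n → Fin n → Fin n → Set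
Edge G u v = T (adj G u v)

neq : ∀ {n} → Fin n → Fin n → Bool
neq u v = not ⌊ u ≟ v ⌋

neq-sym : ∀ {n} (u v : Fin n) → neq u v ≡ neq v u
neq-sym u v with u ≟ v | v ≟ u
... | yes _ | yes _ = refl
... | no _  | no _  = refl
... | yes p | no q with q (sym p)
...   | ()
neq-sym u v | no q | yes p with q (sym p)
...   | ()

neq-irr : ∀ {n} (v : Fin n) → neq v v ≡ false
neq-irr v with v ≟ v
... | yes _ = refl
... | no q with q refl
...   | ()

Complete : (n : ℕ) → Graph n
Complete n = record { adj = neq ; adj-sym = neq-sym ; adj-irr = neq-irr }

record AGraph : Set₁ where
  field
    V : Set
    E : V → V → Bool

_≅_ : AGraph → AGraph → Set
G ≅ H = Σ (AGraph.V G ⤖ AGraph.V H) λ f →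
          ∀ x y → AGraph.E G x y ≡ AGraph.E H (Bijection.to f x) (Bijection.to f y)

record LGraph : Set₁ where
  field
    V   : Set
    E   : V → V → Bool
    lab : V → V → ℕ

_≅ₗ_ : LGraph → LGraph → Set
G ≅ₗ H = Σ (LGraph.V G ⤖ LGraph.V H) λ f →
          (∀ x y → LGraph.E G x y ≡ LGraph.E H (Bijection.to f x) (Bijection.to f y))
          × (∀ x y → T (LGraph.E G x y) →
                LGraph.lab G x y ≡ LGraph.lab H (Bijection.to f x) (Bijection.to f y))

_⊖_ : ∀ {n} → Graph n → Fin n → AGraph
G ⊖ u = record { V = Σ (Fin _) (λ w → False (w ≟ u))
               ; E = λ a b → adj G (proj₁ a) (proj₁ b) }

CutIrregular : ∀ {n} → Graph n → Set
CutIrregular {n} G = ∀ (u v : Fin n) → u ≢ v → ¬ ((G ⊖ u) ≅ (G ⊖ v))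

-- Edge labelings (values in ℤ⁺ = {1,2,...}, only values on edges matter)
-- and labeled links.

record Labeling {n : ℕ} (G : Graph n) : Set where
  field
    lab     : Fin n → Fin n → ℕ
    lab-sym : ∀ u v → Edge G u v → lab u v ≡ lab v u
    lab-pos : ∀ u v → Edge G u v → 1 ≤ lab u v
open Labeling public

Link : ∀ {n} (G : Graph n) → Labeling G → Fin n → LGraph
Link G l v = record { V = Σ (Fin _) (λ w → T (adj G v w))
                    ; E = λ a b → adj G (proj₁ a) (proj₁ b)
                    ; lab = λ a b → lab l (proj₁ a) (proj₁ b) }

LinkIrregular : ∀ {n} (G : Graph n) → Labeling G → Set
LinkIrregular {n} G l = ∀ (u v : Fin n) → u ≢ v → ¬ (Link G l u ≅ₗ Link G l v)

UsesLabels12 : ∀ {n} (G : Graph n) → Labeling G → Set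
UsesLabels12 {n} G l = ∀ (u v : Fin n) → Edge G u v → lab l u v ≡ 1 ⊎ lab l u v ≡ 2

is1 : ℕ → Bool
is1 k = ⌊ k ≟ℕ 1 ⌋

G₁-adj : ∀ {n} → Labeling (Complete n) → Fin n → Fin n → Bool
G₁-adj l u v = neq u v ∧ is1 (lab l u v)

G₁-sym : ∀ {n} (l : Labeling (Complete n)) (u v : Fin n) → G₁-adj l u v ≡ G₁-adj l v u
G₁-sym l u v = aux (neq u v) (neq v u) refl (neq-sym u v)
  where
  aux : ∀ b c → neq u v ≡ b → b ≡ c → b ∧ is1 (lab l u v) ≡ c ∧ is1 (lab l v u)
  aux false .false _ refl = refl
  aux true .true e refl = cong is1 (lab-sym l u v (helper e))
    where
    helper : neq u v ≡ true → T (neq u v)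
    helper e' rewrite e' = _

G₁-irr : ∀ {n} (l : Labeling (Complete n)) (v : Fin n) → G₁-adj l v v ≡ false
G₁-irr l v rewrite neq-irr v = refl

G₁ : ∀ {n} → Labeling (Complete n) → Graph n
G₁ l = record { adj = G₁-adj l ; adj-sym = G₁-sym l ; adj-irr = G₁-irr l }

toAGraph : ∀ {n} → Graph n → AGraph
toAGraph {n} G = record { V = Fin n ; E = adj G }

induced-lab : ∀ {n} → Graph n → Fin n → Fin n → ℕ
induced-lab H u v = if adj H u v then 1 else 2

induced-sym : ∀ {n} (H : Graph n) u v → Edge (Complete n) u v →
              induced-lab H u v ≡ induced-lab H v u
induced-sym H u v _ = cong (λ b → if b then 1 else 2) (adj-sym H u v)

induced-pos : ∀ {n} (H : Graph n) u v → Edge (Complete n) u v → 1 ≤ induced-lab H u v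
induced-pos H u v _ with adj H u v
... | true  = Data.Nat.s≤s Data.Nat.z≤n
... | false = Data.Nat.s≤s Data.Nat.z≤n

inducedLabeling : ∀ {n} → Graph n → Labeling (Complete n)
inducedLabeling H = record { lab = induced-lab H ; lab-sym = induced-sym H ; lab-pos = induced-pos H }

{-# OPTIONS --safe #-}
-- In K_n the labeled link of v is K_n − v carrying the labels of l. When only
-- the labels 1 and 2 occur, a label-preserving isomorphism between two such
-- links is the same thing as an isomorphism between the corresponding
-- vertex-deleted subgraphs of G₁, the graph of edges labeled 1. So a two-label
-- labeling is link-irregular exactly when G₁ is cut-irregular. For the converse
-- statement, note that G₁ of the labeling induced by H is H itself, and that
-- cut-irregularity is invariant under isomorphism.
module Submission where

open import Defs
open import Data.Bool using (Bool; true; false; _∧_; T)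
open import Data.Bool.Properties using (T-irrelevant)
open import Data.Fin using (Fin; _≟_)
open import Data.Nat using (ℕ; _≤_)
open import Data.Product using (Σ; _,_; proj₁; _×_)
open import Data.Product.Function.Dependent.Propositional using (Σ-↔)
open import Data.Sum using (_⊎_; inj₁; inj₂)
open import Function using (_∘_; _↔_; _⤖_; Bijection; Inverse)
open import Function.Properties.Bijection using (⤖⇒↔)
  renaming (refl to ⤖-refl; trans to ⤖-trans)
open import Function.Properties.Inverse using (↔-refl; ↔-sym; ↔⇒⤖)
open import Relation.Nullary using (yes; no; contradiction)
open import Relation.Binary.PropositionalEquality

open Bijection using (to; injective)

T-↔ : ∀ {b c} → b ≡ c → T b ↔ T c
T-↔ refl = ↔-refl

∧-cong-T : ∀ {b b′ c c′} → b ≡ b′ → (T b → c ≡ c′) → b ∧ c ≡ b′ ∧ c′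
∧-cong-T {false} refl _ = refl
∧-cong-T {true}  refl c≡c′ = c≡c′ _

∧-cancelˡ-T : ∀ {b b′ c c′} → T b → T b′ → b ∧ c ≡ b′ ∧ c′ → c ≡ c′
∧-cancelˡ-T {true} {true} _ _ c≡c′ = c≡c′

is1-injective : ∀ {a b} → a ≡ 1 ⊎ a ≡ 2 → b ≡ 1 ⊎ b ≡ 2 → is1 a ≡ is1 b → a ≡ b
is1-injective (inj₁ refl) (inj₁ refl) _  = refl
is1-injective (inj₂ refl) (inj₂ refl) _  = refl
is1-injective (inj₁ refl) (inj₂ refl) ()
is1-injective (inj₂ refl) (inj₁ refl) ()

neq-cong : ∀ {m n} {x y : Fin m} {x′ y′ : Fin n} →
           (x ≡ y → x′ ≡ y′) → (x′ ≡ y′ → x ≡ y) → neq x y ≡ neq x′ y′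
neq-cong {x = x} {y} {x′} {y′} ⇒ ⇐ with x ≟ y | x′ ≟ y′
... | yes _   | yes _    = refl
... | no _    | no _     = refl
... | yes x≡y | no x′≢y′ = contradiction (⇒ x≡y) x′≢y′
... | no x≢y  | yes x′≡y′ = contradiction (⇐ x′≡y′) x≢y

Σᵀ-≡ : ∀ {A : Set} {p : A → Bool} {a b : Σ A (T ∘ p)} → proj₁ a ≡ proj₁ b → a ≡ b
Σᵀ-≡ {a = x , px} {b = .x , qx} refl = cong (x ,_) (T-irrelevant px qx)

Σᵀ-⤖ : ∀ {A B : Set} {p : A → Bool} {q : B → Bool} (f : A ⤖ B) →
       (∀ x → p x ≡ q (to f x)) → Σ A (T ∘ p) ⤖ Σ B (T ∘ q)
Σᵀ-⤖ f p≡q = ↔⇒⤖ (Σ-↔ (⤖⇒↔ f) (T-↔ (p≡q _)))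

neq-preserved : ∀ {m n} {p : Fin m → Bool} {q : Fin n → Bool}
                (g : Σ (Fin m) (T ∘ p) ⤖ Σ (Fin n) (T ∘ q)) x y →
                neq (proj₁ x) (proj₁ y) ≡ neq (proj₁ (to g x)) (proj₁ (to g y))
neq-preserved g x y =
  neq-cong (cong (proj₁ ∘ to g) ∘ Σᵀ-≡) (cong proj₁ ∘ injective g ∘ Σᵀ-≡)

≅-sym : ∀ {G H} → G ≅ H → H ≅ G
≅-sym {G} {H} (f , pres) = ↔⇒⤖ (↔-sym f↔) , pres⁻¹
  where
  f↔ = ⤖⇒↔ f
  open Inverse f↔ using (from; strictlyInverseˡ)
  pres⁻¹ : ∀ x y → AGraph.E H x y ≡ AGraph.E G (from x) (from y)
  pres⁻¹ x y = begin
    AGraph.E H x y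
      ≡⟨ cong₂ (AGraph.E H) (strictlyInverseˡ x) (strictlyInverseˡ y) ⟨
    AGraph.E H (to f (from x)) (to f (from y))
      ≡⟨ pres (from x) (from y) ⟨
    AGraph.E G (from x) (from y)
      ∎
    where open ≡-Reasoning

≅-trans : ∀ {G H K} → G ≅ H → H ≅ K → G ≅ K
≅-trans (f , f-pres) (g , g-pres) =
  ⤖-trans f g , λ x y → trans (f-pres x y) (g-pres (to f x) (to f y))

⊖-≅ : ∀ {n} {G H : Graph n} (φ : toAGraph H ≅ toAGraph G) (u : Fin n) →
      (H ⊖ u) ≅ (G ⊖ to (proj₁ φ) u)
⊖-≅ (f , pres) u =
  Σᵀ-⤖ f (λ w → neq-cong (cong (to f)) (injective f)) , λ a b → pres (proj₁ a) (proj₁ b)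

cutIrregular-≅ : ∀ {n} (G H : Graph n) → toAGraph H ≅ toAGraph G →
                 CutIrregular G → CutIrregular H
cutIrregular-≅ G H φ@(f , _) cutG u v u≢v H⊖u≅H⊖v =
  cutG (to f u) (to f v) (u≢v ∘ injective f) G⊖fu≅G⊖fv
  where
  H⊖≅G⊖ : ∀ w → (H ⊖ w) ≅ (G ⊖ to f w)
  H⊖≅G⊖ = ⊖-≅ {G = G} {H = H} φ
  G⊖fu≅G⊖fv : (G ⊖ to f u) ≅ (G ⊖ to f v)
  G⊖fu≅G⊖fv =
    -- _≅_ unfolds to a Σ-type, so its graph arguments cannot be inferred.
    ≅-trans {G ⊖ to f u} {H ⊖ u} {G ⊖ to f v} (≅-sym {H ⊖ u} {G ⊖ to f u} (H⊖≅G⊖ u))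
      (≅-trans {H ⊖ u} {H ⊖ v} {G ⊖ to f v} H⊖u≅H⊖v (H⊖≅G⊖ v))

-- False (w ≟ v), the vertex predicate of G ⊖ v, unfolds to T (neq w v).
link⤖deleted : ∀ {n} (v : Fin n) →
               Σ (Fin n) (T ∘ neq v) ⤖ Σ (Fin n) (λ w → T (neq w v))
link⤖deleted v = Σᵀ-⤖ ⤖-refl (neq-sym v)

deleted⤖link : ∀ {n} (v : Fin n) →
               Σ (Fin n) (λ w → T (neq w v)) ⤖ Σ (Fin n) (T ∘ neq v)
deleted⤖link v = Σᵀ-⤖ ⤖-refl (λ w → neq-sym w v)

module _ {n : ℕ} (l : Labeling (Complete n)) where

  link≅ₗ⇒G₁⊖≅ : ∀ {u v} → Link (Complete n) l u ≅ₗ Link (Complete n) l v →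
                (G₁ l ⊖ u) ≅ (G₁ l ⊖ v)
  link≅ₗ⇒G₁⊖≅ {u} {v} (g , edge-pres , lab-pres) =
    ⤖-trans (deleted⤖link u) (⤖-trans g (link⤖deleted v)) , λ x y →
      let x′ = to (deleted⤖link u) x; y′ = to (deleted⤖link u) y
      in ∧-cong-T (edge-pres x′ y′) (cong is1 ∘ lab-pres x′ y′)

  G₁⊖≅⇒link≅ₗ : UsesLabels12 (Complete n) l → ∀ {u v} → (G₁ l ⊖ u) ≅ (G₁ l ⊖ v) →
                Link (Complete n) l u ≅ₗ Link (Complete n) l v
  G₁⊖≅⇒link≅ₗ uses12 {u} {v} (f , adj-pres) = g , neq-preserved g , lab-pres
    where
    g = ⤖-trans (link⤖deleted u) (⤖-trans f (deleted⤖link v))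
    lab-pres : ∀ x y → T (neq (proj₁ x) (proj₁ y)) →
               lab l (proj₁ x) (proj₁ y) ≡ lab l (proj₁ (to g x)) (proj₁ (to g y))
    lab-pres x y x≠y = is1-injective (uses12 _ _ x≠y) (uses12 _ _ gx≠gy)
      (∧-cancelˡ-T x≠y gx≠gy (adj-pres (to (link⤖deleted u) x) (to (link⤖deleted u) y)))
      where
      gx≠gy = subst T (neq-preserved g x y) x≠y

  linkIrregular⇒cutIrregular-G₁ : UsesLabels12 (Complete n) l →
                                  LinkIrregular (Complete n) l → CutIrregular (G₁ l)
  linkIrregular⇒cutIrregular-G₁ uses12 irr u v u≢v = irr u v u≢v ∘ G₁⊖≅⇒link≅ₗ uses12

  cutIrregular-G₁⇒linkIrregular : CutIrregular (G₁ l) → LinkIrregular (Complete n) l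
  cutIrregular-G₁⇒linkIrregular cut u v u≢v = cut u v u≢v ∘ link≅ₗ⇒G₁⊖≅

G₁-inducedLabeling-adj : ∀ {n} (H : Graph n) u v → G₁-adj (inducedLabeling H) u v ≡ adj H u v
G₁-inducedLabeling-adj H u v with u ≟ v | adj H u v in uv
... | yes refl | _     = trans (sym (adj-irr H u)) uv
... | no _     | true  = refl
... | no _     | false = refl

G₁-inducedLabeling-≅ : ∀ {n} (H : Graph n) → toAGraph (G₁ (inducedLabeling H)) ≅ toAGraph H
G₁-inducedLabeling-≅ H = ⤖-refl , G₁-inducedLabeling-adj H

inducedLabeling-usesLabels12 : ∀ {n} (H : Graph n) → UsesLabels12 (Complete n) (inducedLabeling H)
inducedLabeling-usesLabels12 H u v _ with adj H u v
... | true  = inj₁ refl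
... | false = inj₂ refl

mainTheorem5 : (n : ℕ) → 1 ≤ n →
    ((l : Labeling (Complete n)) → LinkIrregular (Complete n) l → UsesLabels12 (Complete n) l →
       CutIrregular (G₁ l))
    × ((G H : Graph n) → CutIrregular G → toAGraph H ≅ toAGraph G →
       LinkIrregular (Complete n) (inducedLabeling H) × UsesLabels12 (Complete n) (inducedLabeling H))
mainTheorem5 n _ =
    (λ l irr uses12 → linkIrregular⇒cutIrregular-G₁ l uses12 irr)
  , λ G H cutG H≅G →
      let cutH = cutIrregular-≅ G H H≅G cutG
          cutG₁ = cutIrregular-≅ H (G₁ (inducedLabeling H)) (G₁-inducedLabeling-≅ H) cutH
      in cutIrregular-G₁⇒linkIrregular (inducedLabeling H) cutG₁ , inducedLabeling-usesLabels12 H
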